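{- Let $D$ be an almost bumpless pipe dream of $\pi\in S_n$, and suppose the pipes $p=\pi(x)$ and $q=\pi(y)$ cross exactly once (at a "$+$"-tile $(i,j)$) and bump once (at the bump tile of $D$), where the r-shaped turn in the bump tile belongs to $p$. If we swap the positions of the cross and the bump (replace the tile $(i,j)$ by a bump tile of $p$ and $q$, and the bump tile by a "$+$"-tile of $p$ and $q$, keeping all other tiles), then in the new bump tile at $(i,j)$, the j-shaped turn belongs to $p$.
   Context: A (reduced) bumpless pipe dream (BPD) of size $n$ is a tiling of the $n\times n$ grid (matrix coordinates) by r-tiles (a pipe segment joining the bottom and right edges), j-tiles (a segment joining top and left edges), "$+$"-tiles (two pipes crossing), blank tiles, "$-$"-tiles and "$|$"-tiles, such that there are $n$ pipes, each starting vertically at the south edge and ending horizontally at the east edge (travelling from south to east), and no two pipes cross twice. Labeling pipes $1,\dots,n$ along the south edge left to right and reading labels top to bottom along the east edge gives its permutation $\pi$; the pipe $\pi(x)$ exits in row $x$. A bump tile contains an r-shaped turn (joining bottom and right edges) of one pipe and a j-shaped turn (joining top and left edges) of another pipe, which touch without crossing. An almost bumpless pipe dream of $\pi$ is defined like a BPD of $\pi$ except that exactly one tile is a bump tile (still no two pipes cross twice). -}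

module Defs where

open import Data.Nat using (ℕ; zero; suc; _*_)
open import Data.Fin using (Fin; zero; suc; toℕ; fromℕ; fromℕ<; inject₁; _≟_)
open import Data.Nat.Properties using () renaming (_<?_ to _<ℕ?_)
open import Data.Bool using (Bool; true; false)
open import Data.Maybe using (Maybe; just; nothing)
import Data.Maybe as Maybe
open import Data.List using (List; []; _∷_)
open import Data.List.Membership.Propositional using (_∈_)
open import Data.Product using (Σ; ∃; ∃-syntax; _×_; _,_; map₁)
open import Relation.Binary.PropositionalEquality using (_≡_; _≢_)
open import Relation.Nullary using (yes; no; _×-dec_)
open import Data.Fin.Permutation using (Permutation′; _⟨$⟩ʳ_)

-- Tiles.  r = pipe joining bottom and right edges, j = top and left,
-- plus = crossing, blank, hor = "-", ver = "|",
-- bump = r-turn (bottom–right) of one pipe and j-turn (top–left) of another.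

data Tile : Set where
  r j plus blank hor ver bump : Tile

-- Grid in matrix coordinates: D row col, row 0 is the top row.
Grid : ℕ → Set
Grid n = Fin n → Fin n → Tile

Pos : ℕ → Set
Pos n = Fin n × Fin n

hasTop hasBottom hasLeft hasRight : Tile → Bool
hasTop r = false
hasTop j = true
hasTop plus = true
hasTop blank = false
hasTop hor = false
hasTop ver = true
hasTop bump = true
hasBottom r = true
hasBottom j = false
hasBottom plus = true
hasBottom blank = false
hasBottom hor = false
hasBottom ver = true
hasBottom bump = true
hasLeft r = false
hasLeft j = true
hasLeft plus = true
hasLeft blank = false
hasLeft hor = true
hasLeft ver = false
hasLeft bump = true
hasRight r = true
hasRight j = false
hasRight plus = true
hasRight blank = false
hasRight hor = true
hasRight ver = false
hasRight bump = true

Tiling : ∀ {n} → Grid n → Set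
Tiling {n} D =
    (∀ (a : Fin n) (c c' : Fin n) → toℕ c' ≡ suc (toℕ c) → hasRight (D a c) ≡ hasLeft (D a c'))
  × (∀ (a a' : Fin n) (c : Fin n) → toℕ a ≡ suc (toℕ a') → hasTop (D a c) ≡ hasBottom (D a' c))
  × (∀ (a c : Fin n) → toℕ c ≡ 0 → hasLeft (D a c) ≡ false)
  × (∀ (a c : Fin n) → toℕ a ≡ 0 → hasTop (D a c) ≡ false)
  × (∀ (a c : Fin n) → suc (toℕ a) ≡ n → hasBottom (D a c) ≡ true)
  × (∀ (a c : Fin n) → suc (toℕ c) ≡ n → hasRight (D a c) ≡ true)

data Side : Set where
  fromBottom fromLeft : Side

data Dir : Set where
  toTop toRight : Dir

exitOf : Tile → Side → Maybe Dir
exitOf r fromBottom = just toRight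
exitOf r fromLeft = nothing
exitOf j fromBottom = nothing
exitOf j fromLeft = just toTop
exitOf plus fromBottom = just toTop
exitOf plus fromLeft = just toRight
exitOf blank _ = nothing
exitOf hor fromBottom = nothing
exitOf hor fromLeft = just toRight
exitOf ver fromBottom = just toTop
exitOf ver fromLeft = nothing
exitOf bump fromBottom = just toRight   -- the r-shaped turn
exitOf bump fromLeft = just toTop       -- the j-shaped turn

Step : ℕ → Set
Step n = Fin n × Fin n × Side

up : ∀ {n} → Fin n → Maybe (Fin n)
up zero = nothing
up (suc a) = just (inject₁ a)

right : ∀ {n} → Fin n → Maybe (Fin n)
right {n} c with suc (toℕ c) <ℕ? n
... | yes p = just (fromℕ< p)
... | no _ = nothing

-- trace with fuel; result = list of visited steps and exit row on the east edge
trace : ∀ {n} → ℕ → Grid n → Fin n → Fin n → Side → Maybe (List (Step n) × Fin n)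
traceUp : ∀ {n} → ℕ → Grid n → Fin n → Fin n → Side → Maybe (Fin n) → Maybe (List (Step n) × Fin n)
traceRight : ∀ {n} → ℕ → Grid n → Fin n → Fin n → Side → Maybe (Fin n) → Maybe (List (Step n) × Fin n)
traceDir : ∀ {n} → ℕ → Grid n → Fin n → Fin n → Side → Maybe Dir → Maybe (List (Step n) × Fin n)

trace zero D a c s = nothing
trace (suc f) D a c s = traceDir f D a c s (exitOf (D a c) s)

traceDir f D a c s nothing = nothing
traceDir f D a c s (just toTop) = traceUp f D a c s (up a)
traceDir f D a c s (just toRight) = traceRight f D a c s (right c)

traceUp f D a c s nothing = nothing
traceUp f D a c s (just a') = Maybe.map (map₁ ((a , c , s) ∷_)) (trace f D a' c fromBottom)

traceRight f D a c s nothing = just ((a , c , s) ∷ [] , a)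
traceRight f D a c s (just c') = Maybe.map (map₁ ((a , c , s) ∷_)) (trace f D a c' fromLeft)

lastRow : ∀ {n} → Fin n → Fin n
lastRow {suc m} _ = fromℕ m

-- the pipe labelled c (c-th column on the south edge, 0-indexed) of D
pipe : ∀ {n} → Grid n → Fin n → Maybe (List (Step n) × Fin n)
pipe {n} D c = trace (2 * n) D (lastRow c) c fromBottom

Passes : ∀ {n} → Grid n → Fin n → Pos n → Side → Set
Passes {n} D c (a , b) s = ∃[ path ] ∃[ e ] (pipe D c ≡ just (path , e) × (a , b , s) ∈ path)

Visits : ∀ {n} → Grid n → Fin n → Pos n → Set
Visits D c t = ∃[ s ] Passes D c t s

CrossAt : ∀ {n} → Grid n → Fin n → Fin n → Pos n → Set
CrossAt D p q (a , b) = D a b ≡ plus × Visits D p (a , b) × Visits D q (a , b)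

BumpAt : ∀ {n} → Grid n → Fin n → Fin n → Pos n → Set
BumpAt D p q (a , b) = D a b ≡ bump × Visits D p (a , b) × Visits D q (a , b)

AlmostBPD : ∀ {n} → Permutation′ n → Grid n → Set
AlmostBPD {n} π D =
    Tiling D
  × (∃[ t ] (D (Data.Product.proj₁ t) (Data.Product.proj₂ t) ≡ bump
       × (∀ (a b : Fin n) → D a b ≡ bump → (a , b) ≡ t)))
  × (∀ (x : Fin n) → ∃[ path ] (pipe D (π ⟨$⟩ʳ x) ≡ just (path , x)))
  × (∀ (p q : Fin n) → p ≢ q → ∀ (t₁ t₂ : Pos n) → CrossAt D p q t₁ → CrossAt D p q t₂ → t₁ ≡ t₂)

swapCrossBump : ∀ {n} → Grid n → Pos n → Pos n → Grid n
swapCrossBump D (i , j') (k , l) a b with (a ≟ i) ×-dec (b ≟ j')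
... | yes _ = bump
... | no _ with (a ≟ k) ×-dec (b ≟ l)
...   | yes _ = plus
...   | no _ = D a b

-- Along a pipe the level  column + (n ∸ row)  grows by exactly one per tile, so two pipes
-- meeting a common level are ordered left to right on it, and that order can only change
-- at a tile they share.  Let p enter the bump from below (its r-turn), so q enters it from
-- the left.  If the cross comes first and p enters it from the left, then in the swapped
-- grid p turns up at the new bump, follows q's old route to the new cross and leaves along
-- its own old route.  If the bump comes first and p enters the cross from below, then p
-- runs straight up through the new cross, follows q's old route to the new bump, turns up
-- there and leaves along its own old route.
-- In the two remaining configurations the pipes leave the first of the two tiles in one
-- order and reach the second in the opposite order, which forces a third shared tile, that
-- is a second cross or bump.

module Submission where

open import Defs
open import Data.Fin using (Fin)
open import Data.Product using (_×_; _,_)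
open import Data.Fin.Permutation using (Permutation′; _⟨$⟩ʳ_)
open import Relation.Binary.PropositionalEquality using (_≡_; _≢_)

open import Data.Empty using (⊥; ⊥-elim)
open import Data.Fin using (toℕ; suc; _≟_)
open import Data.Fin.Properties using (toℕ-fromℕ<; toℕ-inject₁; toℕ<n; toℕ-injective)
open import Data.List using (List; []; _∷_; length)
open import Data.List.Membership.Propositional using (_∈_)
open import Data.List.Relation.Binary.Subset.Propositional using (_⊆_)
open import Data.List.Relation.Unary.Any using (here; there)
open import Data.Maybe using (just; nothing)
open import Data.Nat using (ℕ; suc; _+_; _*_; _∸_; _≤_; _<_; s≤s)
open import Data.Nat.Properties
  using (≤-refl; ≤-trans; ≤-antisym; ≤-reflexive; <-trans; <⇒≤; <⇒≢; >⇒≢; <-irrefl; <-asym;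
         ≮⇒≥; <-cmp; n≤1+n; m≤m+n; m∸n≤m; +-suc; +-identityʳ; +-monoʳ-≤; +-∸-assoc; +-cancelˡ-≡;
         ∸-cancelˡ-≡; module ≤-Reasoning)
  renaming (_<?_ to _<ℕ?_)
open import Data.Product using (∃; proj₁; proj₂)
open import Data.Sum using (_⊎_; inj₁; inj₂; [_,_])
open import Relation.Binary.Definitions using (tri<; tri≈; tri>)
open import Relation.Binary.PropositionalEquality using (refl; sym; trans; cong; cong₂; subst)
open import Relation.Nullary using (yes; no; _×-dec_)

exits-as : ∀ {t t'} s → t ≡ t' → exitOf t s ≡ exitOf t' s
exits-as s = cong (λ t → exitOf t s)

exits-both⇒plus⊎bump : ∀ {t d d'} → exitOf t fromBottom ≡ just d → exitOf t fromLeft ≡ just d' →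
                       t ≡ plus ⊎ t ≡ bump
exits-both⇒plus⊎bump {plus} _ _ = inj₁ refl
exits-both⇒plus⊎bump {bump} _ _ = inj₂ refl
exits-both⇒plus⊎bump {r} _ ()
exits-both⇒plus⊎bump {j} () _
exits-both⇒plus⊎bump {blank} () _
exits-both⇒plus⊎bump {hor} () _
exits-both⇒plus⊎bump {ver} _ ()

module _ {n : ℕ} where

  private
    variable
      D D' : Grid n
      a a' c c' : Fin n
      s s' u u' : Side
      d d' : Dir
      σ σ₁ σ₂ τ ρ : Step n
      P P₁ P₂ Q Q₁ Q₂ T U : List (Step n)
      e e' e₁ e₂ : Fin n
      lo lo' hi : ℕ

  position : Step n → Pos n
  position (a , c , _) = a , c

  column : Step n → ℕ
  column (_ , c , _) = toℕ c

  tileAt : Grid n → Step n → Tile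
  tileAt D (a , c , _) = D a c

  level : Step n → ℕ
  level (a , c , _) = toℕ c + (n ∸ toℕ a)

  up-height : up a ≡ just a' → n ∸ toℕ a' ≡ suc (n ∸ toℕ a)
  up-height {a = suc a} refl rewrite toℕ-inject₁ a = +-∸-assoc 1 (<⇒≤ (toℕ<n a))

  right-column : ∀ {c c' : Fin n} → right c ≡ just c' → toℕ c' ≡ suc (toℕ c)
  right-column {c} eq with suc (toℕ c) <ℕ? n
  right-column refl | yes c+1<n = toℕ-fromℕ< c+1<n

  right-nothing : ∀ {c : Fin n} → right c ≡ nothing → suc (toℕ c) ≡ n
  right-nothing {c} eq with suc (toℕ c) <ℕ? n
  right-nothing () | yes _
  ... | no c+1≮n = ≤-antisym (toℕ<n c) (≮⇒≥ c+1≮n)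

  level-column-injective : level σ ≡ level τ → column σ ≡ column τ → position σ ≡ position τ
  level-column-injective {a , c , _} {a' , c' , _} level≡ column≡ =
    cong₂ _,_ (toℕ-injective (∸-cancelˡ-≡ (<⇒≤ (toℕ<n a)) (<⇒≤ (toℕ<n a'))
                (+-cancelˡ-≡ (toℕ c) _ _ (trans level≡ (cong (_+ (n ∸ toℕ a')) (sym column≡))))))
              (toℕ-injective column≡)

  level≢⇒position≢ : level σ ≢ level τ → position σ ≢ position τ
  level≢⇒position≢ {σ = _ , _ , _} {_ , _ , _} level≢ refl = level≢ refl

  data Move : Dir → Step n → Step n → Set where
    moveUp    : up a ≡ just a' → Move toTop (a , c , s) (a' , c , fromBottom)
    moveRight : right c ≡ just c' → Move toRight (a , c , s) (a , c' , fromLeft)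

  Move-level : Move d σ τ → level τ ≡ suc (level σ)
  Move-level {σ = _ , c , _} (moveUp ue) = trans (cong (toℕ c +_) (up-height ue)) (+-suc _ _)
  Move-level {σ = a , _ , _} (moveRight re) = cong (_+ (_ ∸ toℕ a)) (right-column re)

  Move-level< : Move d σ τ → level σ < level τ
  Move-level< mv = ≤-reflexive (sym (Move-level mv))

  Move-level-≡ : Move d σ₁ τ → Move d' σ₂ ρ → level σ₁ ≡ level σ₂ → level τ ≡ level ρ
  Move-level-≡ mv₁ mv₂ eq = trans (Move-level mv₁) (trans (cong suc eq) (sym (Move-level mv₂)))

  Move-column-≤ : Move d σ τ → column σ ≤ column τ
  Move-column-≤ (moveUp _) = ≤-refl
  Move-column-≤ {σ = _ , c , _} (moveRight re) =
    ≤-trans (n≤1+n (toℕ c)) (≤-reflexive (sym (right-column re)))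

  Move-column-≤-suc : Move d σ τ → column τ ≤ suc (column σ)
  Move-column-≤-suc {σ = _ , c , _} (moveUp _) = n≤1+n (toℕ c)
  Move-column-≤-suc (moveRight re) = ≤-reflexive (right-column re)

  left-entry<bottom-entry : Move d σ₁ (a , c , fromLeft) → Move d' σ₂ (a , c , fromBottom) →
                            column σ₁ < column σ₂
  left-entry<bottom-entry (moveRight re) (moveUp _) = ≤-reflexive (sym (right-column re))

  Move-side : Move d (a , c , s) τ → Move d (a , c , s') τ
  Move-side (moveUp ue) = moveUp ue
  Move-side (moveRight re) = moveRight re

  Move-deterministic : Move d σ τ → Move d σ ρ → τ ≡ ρ
  Move-deterministic (moveUp ue) (moveUp ue') with trans (sym ue) ue'
  ... | refl = refl
  Move-deterministic (moveRight re) (moveRight re') with trans (sym re) re'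
  ... | refl = refl

  -- The relational form of `trace`: the pipe entering step σ visits the steps P and
  -- leaves the grid through the east edge in row e.
  data Run (D : Grid n) : Step n → List (Step n) → Fin n → Set where
    leave : exitOf (D a c) s ≡ just toRight → right c ≡ nothing →
            Run D (a , c , s) ((a , c , s) ∷ []) a
    move  : exitOf (D a c) s ≡ just d → Move d (a , c , s) σ → Run D σ P e →
            Run D (a , c , s) ((a , c , s) ∷ P) e

  trace-sound : ∀ (D : Grid n) f a c s → trace f D a c s ≡ just (P , e) → Run D (a , c , s) P e
  trace-sound D (suc f) a c s eq with exitOf (D a c) s in ex
  ... | just toTop with up a in ue
  ...   | just a' with trace f D a' c fromBottom in tr
  ...     | just _ with refl ← eq = move ex (moveUp ue) (trace-sound D f a' c fromBottom tr)
  trace-sound D (suc f) a c s eq | just toRight with right c in re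
  ... | nothing with refl ← eq = leave ex re
  ... | just c' with trace f D a c' fromLeft in tr
  ...   | just _ with refl ← eq = move ex (moveRight re) (trace-sound D f a c' fromLeft tr)

  trace-complete : Run D (a , c , s) P e → ∀ f → length P ≤ f → trace f D a c s ≡ just (P , e)
  trace-complete (leave ex re) (suc f) _ rewrite ex | re = refl
  trace-complete (move ex (moveUp ue) R) (suc f) (s≤s len≤f)
    rewrite ex | ue | trace-complete R f len≤f = refl
  trace-complete (move ex (moveRight re) R) (suc f) (s≤s len≤f)
    rewrite ex | re | trace-complete R f len≤f = refl

  Run-length : Run D σ P e → length P + level σ ≤ 2 * n
  Run-length {σ = a , c , _} (leave _ re) = begin
    suc (toℕ c + (n ∸ toℕ a)) ≡⟨ cong (_+ (n ∸ toℕ a)) (right-nothing re) ⟩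
    n + (n ∸ toℕ a)           ≤⟨ +-monoʳ-≤ n (m∸n≤m n (toℕ a)) ⟩
    n + n                     ≡⟨ cong (n +_) (sym (+-identityʳ n)) ⟩
    2 * n                     ∎
    where open ≤-Reasoning
  Run-length {P = _ ∷ P} (move _ mv R) =
    subst (_≤ 2 * n) (trans (cong (length P +_) (Move-level mv)) (+-suc _ _)) (Run-length R)

  pipe-run : pipe D c ≡ just (P , e) → Run D (lastRow c , c , fromBottom) P e
  pipe-run {D = D} = trace-sound D (2 * n) _ _ _

  run-pipe : Run D (lastRow c , c , fromBottom) P e → pipe D c ≡ just (P , e)
  run-pipe R = trace-complete R _ (≤-trans (m≤m+n _ _) (Run-length R))

  Run-head : Run D σ P e → σ ∈ P
  Run-head (leave _ _) = here refl
  Run-head (move _ _ _) = here refl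

  Run-head-≡ : Run D σ (τ ∷ T) e → τ ≡ σ
  Run-head-≡ (leave _ _) = refl
  Run-head-≡ (move _ _ _) = refl

  Run-tail-level : Run D σ (τ ∷ T) e → ρ ∈ T → level σ < level ρ
  Run-head⊎later : Run D σ P e → ρ ∈ P → ρ ≡ σ ⊎ level σ < level ρ

  Run-tail-level (move _ mv R) ρ∈T with Run-head⊎later R ρ∈T
  ... | inj₁ refl = Move-level< mv
  ... | inj₂ later = <-trans (Move-level< mv) later

  Run-head⊎later (leave _ _) (here refl) = inj₁ refl
  Run-head⊎later (move _ _ _) (here refl) = inj₁ refl
  Run-head⊎later R@(move _ _ _) (there ρ∈P) = inj₂ (Run-tail-level R ρ∈P)

  Run-level-injective : Run D σ P e → τ ∈ P → ρ ∈ P → level τ ≡ level ρ → τ ≡ ρ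
  Run-level-injective _ (here refl) (here refl) _ = refl
  Run-level-injective R@(move _ _ _) (here refl) (there ρ∈P) eq =
    ⊥-elim (<⇒≢ (Run-tail-level R ρ∈P) eq)
  Run-level-injective R@(move _ _ _) (there τ∈P) (here refl) eq =
    ⊥-elim (>⇒≢ (Run-tail-level R τ∈P) eq)
  Run-level-injective (move _ _ R) (there τ∈P) (there ρ∈P) eq = Run-level-injective R τ∈P ρ∈P eq

  Run-exits : Run D σ P e → (a , c , s) ∈ P → ∃ λ d → exitOf (D a c) s ≡ just d
  Run-exits (leave ex _) (here refl) = _ , ex
  Run-exits (move ex _ _) (here refl) = _ , ex
  Run-exits (move _ _ R) (there m) = Run-exits R m

  ∈-drop-head : ρ ∈ (τ ∷ T) → level τ < level ρ → ρ ∈ T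
  ∈-drop-head (here refl) lt = ⊥-elim (<-irrefl refl lt)
  ∈-drop-head (there m) _ = m

  Run-suffix : Run D σ P e → τ ∈ P →
               ∃ λ T → Run D τ (τ ∷ T) e × T ⊆ P × (∀ {ρ} → ρ ∈ P → level τ < level ρ → ρ ∈ T)
  Run-suffix R (here refl) with refl ← Run-head-≡ R = _ , R , there , ∈-drop-head
  Run-suffix {P = P} {τ = τ} R@(move _ _ R') (there τ∈P) with Run-suffix R' τ∈P
  ... | T , Rτ , T⊆P , later∈T = T , Rτ , (λ m → there (T⊆P m)) , later∈T'
    where later∈T' : ρ ∈ P → level τ < level ρ → ρ ∈ T
          later∈T' (here refl) lt = ⊥-elim (<-asym lt (Run-tail-level R τ∈P))
          later∈T' (there m) lt = later∈T m lt

  leave-or-move : ∀ {t} → exitOf t s ≡ just toRight → right c ≡ nothing →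
                  exitOf t s ≡ just d → Move d (a , c , s) τ → ⊥
  leave-or-move ex re ex' mv with trans (sym ex) ex' | mv
  ... | refl | moveRight re' with trans (sym re) re'
  ...   | ()

  Run-exit-unique : Run D σ P e → Run D σ Q e' → e ≡ e'
  Run-exit-unique (leave _ _) (leave _ _) = refl
  Run-exit-unique (leave ex re) (move ex' mv _) = ⊥-elim (leave-or-move ex re ex' mv)
  Run-exit-unique (move ex mv _) (leave ex' re) = ⊥-elim (leave-or-move ex' re ex mv)
  Run-exit-unique (move ex mv R) (move ex' mv' R') with trans (sym ex) ex'
  ... | refl with Move-deterministic mv mv'
  ...   | refl = Run-exit-unique R R'

  Run-up : Run D (a , c , s) ((a , c , s) ∷ T) e → exitOf (D a c) s ≡ just toTop →
           ∃ λ a' → up a ≡ just a' × Run D (a' , c , fromBottom) T e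
  Run-up (move _ (moveUp ue) R) _ = _ , ue , R
  Run-up (leave ex _) ex' with trans (sym ex) ex'
  ... | ()
  Run-up (move ex (moveRight _) _) ex' with trans (sym ex) ex'
  ... | ()

  Run-right : Run D (a , c , s) ((a , c , s) ∷ T) e → exitOf (D a c) s ≡ just toRight → ρ ∈ T →
              ∃ λ c' → right c ≡ just c' × Run D (a , c' , fromLeft) T e
  Run-right (move _ (moveRight re) R) _ _ = _ , re , R
  Run-right (move ex (moveUp _) _) ex' _ with trans (sym ex) ex'
  ... | ()

  retile : ∀ {t t'} → t' ≡ t → exitOf t s ≡ just d → exitOf t' s ≡ just d
  retile {s = s} t'≡t ex = trans (exits-as s t'≡t) ex

  Run-transfer : Run D σ P e → (∀ {ρ} → ρ ∈ P → tileAt D' ρ ≡ tileAt D ρ) → Run D' σ P e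
  Run-transfer (leave ex re) same = leave (retile (same (here refl)) ex) re
  Run-transfer (move ex mv R) same =
    move (retile (same (here refl)) ex) mv (Run-transfer R (λ m → same (there m)))

  Run-reroute : Run D σ P e → τ ∈ P → (∀ {ρ} → ρ ∈ P → level ρ < level τ → tileAt D' ρ ≡ tileAt D ρ) →
                Run D' τ U e' → ∃ λ P' → Run D' σ P' e' × U ⊆ P'
  Run-reroute R (here refl) _ Rτ with refl ← Run-head-≡ R = _ , Rτ , λ m → m
  Run-reroute R@(move ex mv R') (there τ∈P) same Rτ
    with Run-reroute R' τ∈P (λ m → same (there m)) Rτ
  ... | _ , R'' , U⊆ =
    _ , move (retile (same (here refl) (Run-tail-level R τ∈P)) ex) mv R'' , λ m → there (U⊆ m)

  Run-reenter : Run D (a , c , s) ((a , c , s) ∷ T) e → exitOf (D' a c) s' ≡ exitOf (D a c) s →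
                (∀ {ρ} → ρ ∈ T → tileAt D' ρ ≡ tileAt D ρ) → Run D' (a , c , s') ((a , c , s') ∷ T) e
  Run-reenter (leave ex re) exits≡ _ = leave (trans exits≡ ex) re
  Run-reenter (move ex mv R) exits≡ same = move (trans exits≡ ex) (Move-side mv) (Run-transfer R same)

  Run-redirect : Run D (a , c , s) ((a , c , s) ∷ T) e → τ ∈ T → exitOf (D' a c) s' ≡ exitOf (D a c) s →
                 (∀ {ρ} → ρ ∈ T → level ρ < level τ → tileAt D' ρ ≡ tileAt D ρ) → Run D' τ U e' →
                 ∃ λ T' → Run D' (a , c , s') ((a , c , s') ∷ T') e' × U ⊆ T'
  Run-redirect (move ex mv R) τ∈T exits≡ same Rτ with Run-reroute R τ∈T same Rτ
  ... | T' , R' , U⊆ = T' , move (trans exits≡ ex) (Move-side mv) R' , U⊆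

  data Meet (P₁ P₂ : List (Step n)) (lo hi : ℕ) : Set where
    meet : (a , c , s) ∈ P₁ → (a , c , s') ∈ P₂ → lo < level (a , c , s) → level (a , c , s) < hi →
           Meet P₁ P₂ lo hi

  meet-at : σ ∈ P₁ → τ ∈ P₂ → position σ ≡ position τ → lo < level σ → level σ < hi → Meet P₁ P₂ lo hi
  meet-at {σ = _ , _ , _} {τ = _ , _ , _} σ∈P₁ τ∈P₂ refl = meet σ∈P₁ τ∈P₂

  Meet-mono : P₁ ⊆ Q₁ → P₂ ⊆ Q₂ → lo' ≤ lo → Meet P₁ P₂ lo hi → Meet Q₁ Q₂ lo' hi
  Meet-mono P₁⊆Q₁ P₂⊆Q₂ lo'≤lo (meet m₁ m₂ above below) =
    meet (P₁⊆Q₁ m₁) (P₂⊆Q₂ m₂) (≤-trans (s≤s lo'≤lo) above) below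

  -- Until two pipes on a common level share a tile, the one starting further left stays
  -- in a smaller column; so the right one cannot enter a tile from the left while the
  -- left one enters it from below.
  overtaking-runs-meet : Run D σ₁ P₁ e₁ → Run D σ₂ P₂ e₂ →
                         level σ₁ ≡ level σ₂ → column σ₂ < column σ₁ →
                         (a , c , fromLeft) ∈ P₁ → (a , c , fromBottom) ∈ P₂ →
                         Meet P₁ P₂ (level σ₁) (level (a , c , fromLeft))
  overtaking-runs-meet R₁ R₂ ℓ≡ lt (here refl) m₂ with refl ← Run-head-≡ R₁ =
    ⊥-elim (<-irrefl (cong column (Run-level-injective R₂ (Run-head R₂) m₂ (sym ℓ≡))) lt)
  overtaking-runs-meet R₁ R₂ ℓ≡ lt (there m₁) (here refl) with refl ← Run-head-≡ R₂ =
    ⊥-elim (<⇒≢ (Run-tail-level R₁ m₁) ℓ≡)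
  overtaking-runs-meet (move {σ = σ₁'} _ mv₁ R₁) (move {σ = σ₂'} _ mv₂ R₂) ℓ≡ lt
                       (there m₁) (there m₂) with Run-head⊎later R₁ m₁
  ... | inj₁ refl with refl ← Run-level-injective R₂ (Run-head R₂) m₂ (sym (Move-level-≡ mv₁ mv₂ ℓ≡)) =
    ⊥-elim (<-asym lt (left-entry<bottom-entry mv₁ mv₂))
  ... | inj₂ below with column σ₂' <ℕ? column σ₁'
  ...   | yes lt' = Meet-mono there there (<⇒≤ (Move-level< mv₁))
                      (overtaking-runs-meet R₁ R₂ (Move-level-≡ mv₁ mv₂ ℓ≡) lt' m₁ m₂)
  ...   | no ≮ = meet-at (there (Run-head R₁)) (there (Run-head R₂))
                   (level-column-injective {σ₁'} {σ₂'} (Move-level-≡ mv₁ mv₂ ℓ≡)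
                      (≤-antisym (≮⇒≥ ≮)
                         (≤-trans (Move-column-≤-suc mv₂) (≤-trans lt (Move-column-≤ mv₁)))))
                   (Move-level< mv₁) below

  diverging-runs-meet : Run D σ₁ P₁ e₁ → Run D σ₂ P₂ e₂ → (a , c , s) ∈ P₁ → (a , c , s') ∈ P₂ →
                        exitOf (D a c) s ≡ just toRight → exitOf (D a c) s' ≡ just toTop →
                        (a' , c' , fromLeft) ∈ P₁ → (a' , c' , fromBottom) ∈ P₂ →
                        level (a , c , s) < level (a' , c' , fromLeft) →
                        Meet P₁ P₂ (level (a , c , s)) (level (a' , c' , fromLeft))
  diverging-runs-meet {a = a} {s = s} {s' = s'} R₁ R₂ m₁ m₂ ex-right ex-up m₁' m₂' lt
    with Run-suffix R₁ m₁ | Run-suffix R₂ m₂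
  ... | _ , S₁ , T₁⊆P₁ , later₁ | _ , S₂ , T₂⊆P₂ , later₂
    with Run-right S₁ ex-right (later₁ m₁' lt) | Run-up S₂ ex-up
  ... | _ , re , S₁' | _ , ue , S₂' =
    Meet-mono T₁⊆P₁ T₂⊆P₂ (<⇒≤ (Move-level< (moveRight {a = a} {s = s} re)))
      (overtaking-runs-meet S₁' S₂' (Move-level-≡ (moveRight {a = a} {s = s} re) (moveUp {s = s'} ue) refl)
         (≤-reflexive (sym (right-column re))) (later₁ m₁' lt) (later₂ m₂' lt))

  -- In the new grid the pipe follows its old route up to the first tile, the other pipe's
  -- old route between the two tiles, and its own old route after the second tile.
  exchange-routes : Run D σ P e → Run D τ Q e' →
                    (a , c , s) ∈ P → (a , c , s') ∈ Q → (a' , c' , u) ∈ P → (a' , c' , u') ∈ Q →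
                    level (a , c , s) < level (a' , c' , u) →
                    exitOf (D' a c) s ≡ exitOf (D a c) s' → exitOf (D' a' c') u' ≡ exitOf (D a' c') u →
                    (∀ {ρ} → level ρ ≢ level (a , c , s) → level ρ ≢ level (a' , c' , u) →
                       tileAt D' ρ ≡ tileAt D ρ) →
                    ∃ λ P' → Run D' σ P' e × (a , c , s) ∈ P' × (a' , c' , u') ∈ P'
  exchange-routes RP RQ p₁ q₁ p₂ q₂ lt exits₁ exits₂ same
    with Run-suffix RP p₂ | Run-suffix RQ q₁
  ... | _ , Rp₂ , _ , _ | _ , Rq₁ , _ , later =
    let p-after = Run-reenter Rp₂ exits₂ λ {ρ} m →
                    same {ρ} (>⇒≢ (<-trans lt (Run-tail-level Rp₂ m))) (>⇒≢ (Run-tail-level Rp₂ m))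
        _ , q-between , ⊆V' = Run-redirect Rq₁ (later q₂ lt) exits₁
                                (λ {ρ} m below → same {ρ} (>⇒≢ (Run-tail-level Rq₁ m)) (<⇒≢ below)) p-after
        P' , R' , ⊆P' = Run-reroute RP p₁
                          (λ {ρ} _ below → same {ρ} (<⇒≢ below) (<⇒≢ (<-trans below lt))) q-between
    in P' , R' , ⊆P' (here refl) , ⊆P' (there (⊆V' (here refl)))

  passes-on : pipe D c ≡ just (P , e) → Passes D c (a , a') s → (a , a' , s) ∈ P
  passes-on pipe≡ (_ , _ , pipe≡' , m) with trans (sym pipe≡) pipe≡'
  ... | refl = m

  swapCrossBump-cross : swapCrossBump D (a , c) (a' , c') a c ≡ bump
  swapCrossBump-cross {a = a} {c} with (a ≟ a) ×-dec (c ≟ c)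
  ... | yes _ = refl
  ... | no ≢ = ⊥-elim (≢ (refl , refl))

  swapCrossBump-bump : (a' , c') ≢ (a , c) → swapCrossBump D (a , c) (a' , c') a' c' ≡ plus
  swapCrossBump-bump {a'} {c'} {a} {c} ≢cross with (a' ≟ a) ×-dec (c' ≟ c)
  ... | yes (refl , refl) = ⊥-elim (≢cross refl)
  ... | no _ with (a' ≟ a') ×-dec (c' ≟ c')
  ...   | yes _ = refl
  ...   | no ≢ = ⊥-elim (≢ (refl , refl))

  swapCrossBump-other : position ρ ≢ (a , c) → position ρ ≢ (a' , c') →
                        tileAt (swapCrossBump D (a , c) (a' , c')) ρ ≡ tileAt D ρ
  swapCrossBump-other {ρ = b , b' , _} {a} {c} {a'} {c'} ≢cross ≢bump with (b ≟ a) ×-dec (b' ≟ c)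
  ... | yes (refl , refl) = ⊥-elim (≢cross refl)
  ... | no _ with (b ≟ a') ×-dec (b' ≟ c')
  ...   | yes (refl , refl) = ⊥-elim (≢bump refl)
  ...   | no _ = refl

-- The column of the cross is called j′ because j is a tile constructor.
module CrossBumpSwap
  {n} {D : Grid n} {p q x y : Fin n} (x≢y : x ≢ y) {P Q : List (Step n)}
  (pipe-p : pipe D p ≡ just (P , x)) (pipe-q : pipe D q ≡ just (Q , y))
  {i j′ k l : Fin n}
  (D-cross : D i j′ ≡ plus) (cross-unique : ∀ t → CrossAt D p q t → t ≡ (i , j′))
  (D-bump : D k l ≡ bump) (bump-unique : ∀ a c → D a c ≡ bump → (a , c) ≡ (k , l))
  (p-bump : (k , l , fromBottom) ∈ P) {s} (q-bump : (k , l , s) ∈ Q)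
  where

  D' : Grid n
  D' = swapCrossBump D (i , j′) (k , l)

  ℓc ℓb : ℕ
  ℓc = level (i , j′ , fromBottom)
  ℓb = level (k , l , fromBottom)

  RP : Run D (lastRow p , p , fromBottom) P x
  RP = pipe-run pipe-p

  RQ : Run D (lastRow q , q , fromBottom) Q y
  RQ = pipe-run pipe-q

  no-common-step : ∀ {σ} → σ ∈ P → σ ∈ Q → ⊥
  no-common-step σ∈P σ∈Q with Run-suffix RP σ∈P | Run-suffix RQ σ∈Q
  ... | _ , Rp , _ | _ , Rq , _ = x≢y (Run-exit-unique Rp Rq)

  q-bump-left : (k , l , fromLeft) ∈ Q
  q-bump-left = enters-from-left q-bump
    where enters-from-left : ∀ {s} → (k , l , s) ∈ Q → (k , l , fromLeft) ∈ Q
          enters-from-left {fromLeft} m = m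
          enters-from-left {fromBottom} m = ⊥-elim (no-common-step p-bump m)

  shared-tile : ∀ {a c s₁ s₂} → (a , c , s₁) ∈ P → (a , c , s₂) ∈ Q → D a c ≡ plus ⊎ D a c ≡ bump
  shared-tile {s₁ = fromBottom} {fromBottom} m₁ m₂ = ⊥-elim (no-common-step m₁ m₂)
  shared-tile {s₁ = fromLeft} {fromLeft} m₁ m₂ = ⊥-elim (no-common-step m₁ m₂)
  shared-tile {s₁ = fromBottom} {fromLeft} m₁ m₂ =
    exits-both⇒plus⊎bump (proj₂ (Run-exits RP m₁)) (proj₂ (Run-exits RQ m₂))
  shared-tile {s₁ = fromLeft} {fromBottom} m₁ m₂ =
    exits-both⇒plus⊎bump (proj₂ (Run-exits RQ m₂)) (proj₂ (Run-exits RP m₁))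

  shared-level : ∀ {a c s₁ s₂} → (a , c , s₁) ∈ P → (a , c , s₂) ∈ Q →
                 level (a , c , s₁) ≡ ℓc ⊎ level (a , c , s₁) ≡ ℓb
  shared-level m₁ m₂ with shared-tile m₁ m₂
  ... | inj₁ D≡plus = inj₁ (cong (λ (a , c) → level (a , c , fromBottom))
                             (cross-unique _ (D≡plus , (_ , _ , _ , pipe-p , m₁) , (_ , _ , _ , pipe-q , m₂))))
  ... | inj₂ D≡bump = inj₂ (cong (λ (a , c) → level (a , c , fromBottom)) (bump-unique _ _ D≡bump))

  no-meeting-after-bump : Meet P Q ℓb ℓc → ⊥
  no-meeting-after-bump (meet m₁ m₂ above below) = [ <⇒≢ below , >⇒≢ above ] (shared-level m₁ m₂)

  no-meeting-after-cross : Meet Q P ℓc ℓb → ⊥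
  no-meeting-after-cross (meet m₁ m₂ above below) = [ >⇒≢ above , <⇒≢ below ] (shared-level m₂ m₁)

  bump≢cross : (k , l) ≢ (i , j′)
  bump≢cross eq with trans (sym D-bump) (trans (cong (λ (a , c) → D a c) eq) D-cross)
  ... | ()

  ℓc≢ℓb : ∀ {s} → (i , j′ , s) ∈ P → ℓc ≢ ℓb
  ℓc≢ℓb p-cross eq = bump≢cross (cong position (Run-level-injective RP p-bump p-cross (sym eq)))

  unchanged : ∀ {ρ} → level ρ ≢ ℓc → level ρ ≢ ℓb → tileAt D' ρ ≡ tileAt D ρ
  unchanged {ρ} ≢ℓc ≢ℓb = swapCrossBump-other {ρ = ρ}
    (level≢⇒position≢ {σ = ρ} {τ = i , j′ , fromBottom} ≢ℓc)
    (level≢⇒position≢ {σ = ρ} {τ = k , l , fromBottom} ≢ℓb)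

  D'-cross : D' i j′ ≡ bump
  D'-cross = swapCrossBump-cross {D = D} {a = i} {c = j′} {a' = k} {c' = l}

  D'-bump : D' k l ≡ plus
  D'-bump = swapCrossBump-bump {a = i} {c = j′} {D = D} bump≢cross

  cross-left-exits : exitOf (D' i j′) fromLeft ≡ exitOf (D i j′) fromBottom
  cross-left-exits = trans (exits-as fromLeft D'-cross) (exits-as fromBottom (sym D-cross))

  bump-left-exits : exitOf (D' k l) fromLeft ≡ exitOf (D k l) fromBottom
  bump-left-exits = trans (exits-as fromLeft D'-bump) (exits-as fromBottom (sym D-bump))

  bump-bottom-exits : exitOf (D' k l) fromBottom ≡ exitOf (D k l) fromLeft
  bump-bottom-exits = trans (exits-as fromBottom D'-bump) (exits-as fromLeft (sym D-bump))

  run-passes : ∀ {P' a c s} → Run D' (lastRow p , p , fromBottom) P' x → (a , c , s) ∈ P' →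
               Passes D' p (a , c) s
  run-passes R m = _ , x , run-pipe R , m

  passes-from-left : ∀ {sp sq} → (i , j′ , sp) ∈ P → (i , j′ , sq) ∈ Q → Passes D' p (i , j′) fromLeft
  passes-from-left {fromBottom} {fromBottom} p-cross q-cross = ⊥-elim (no-common-step p-cross q-cross)
  passes-from-left {fromLeft} {fromLeft} p-cross q-cross = ⊥-elim (no-common-step p-cross q-cross)
  passes-from-left {fromLeft} {fromBottom} p-cross q-cross with <-cmp ℓc ℓb
  ... | tri< ℓc<ℓb _ _ =
    let _ , R , p-cross' , _ = exchange-routes RP RQ p-cross q-cross p-bump q-bump-left ℓc<ℓb
                                 cross-left-exits bump-left-exits (λ {ρ} → unchanged {ρ})
    in run-passes R p-cross'
  ... | tri≈ _ ℓc≡ℓb _ = ⊥-elim (ℓc≢ℓb p-cross ℓc≡ℓb)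
  ... | tri> _ _ ℓb<ℓc = ⊥-elim (no-meeting-after-bump
                           (diverging-runs-meet RP RQ p-bump q-bump-left (exits-as fromBottom D-bump)
                              (exits-as fromLeft D-bump) p-cross q-cross ℓb<ℓc))
  passes-from-left {fromBottom} {fromLeft} p-cross q-cross with <-cmp ℓc ℓb
  ... | tri< ℓc<ℓb _ _ = ⊥-elim (no-meeting-after-cross
                           (diverging-runs-meet RQ RP q-cross p-cross (exits-as fromLeft D-cross)
                              (exits-as fromBottom D-cross) q-bump-left p-bump ℓc<ℓb))
  ... | tri≈ _ ℓc≡ℓb _ = ⊥-elim (ℓc≢ℓb p-cross ℓc≡ℓb)
  ... | tri> _ _ ℓb<ℓc =
    let _ , R , _ , p-cross' = exchange-routes RP RQ p-bump q-bump-left p-cross q-cross ℓb<ℓc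
                                 bump-bottom-exits cross-left-exits
                                 (λ {ρ} ≢ℓb ≢ℓc → unchanged {ρ} ≢ℓc ≢ℓb)
    in run-passes R p-cross'

mainTheorem6 : ∀ {n} (π : Permutation′ n) (D : Grid n) → AlmostBPD π D →
    ∀ (x y : Fin n) → x ≢ y →
    ∀ (i j k l : Fin n) →
    CrossAt D (π ⟨$⟩ʳ x) (π ⟨$⟩ʳ y) (i , j) →
    (∀ (t : Pos n) → CrossAt D (π ⟨$⟩ʳ x) (π ⟨$⟩ʳ y) t → t ≡ (i , j)) →
    BumpAt D (π ⟨$⟩ʳ x) (π ⟨$⟩ʳ y) (k , l) →
    Passes D (π ⟨$⟩ʳ x) (k , l) fromBottom →
    Passes (swapCrossBump D (i , j) (k , l)) (π ⟨$⟩ʳ x) (i , j) fromLeft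
mainTheorem6 π D (_ , (_ , _ , bump-at) , exits , _) x y x≢y i j′ k l
             (D-cross , (_ , p-cross) , (_ , q-cross)) cross-unique (D-bump , _ , (_ , q-bump)) p-bump =
  passes-from-left (passes-on pipe-p p-cross) (passes-on pipe-q q-cross)
  where
    pipe-p : pipe D (π ⟨$⟩ʳ x) ≡ just (proj₁ (exits x) , x)
    pipe-p = proj₂ (exits x)

    pipe-q : pipe D (π ⟨$⟩ʳ y) ≡ just (proj₁ (exits y) , y)
    pipe-q = proj₂ (exits y)

    bump-unique : ∀ a c → D a c ≡ bump → (a , c) ≡ (k , l)
    bump-unique a c D≡bump = trans (bump-at a c D≡bump) (sym (bump-at k l D-bump))

    open CrossBumpSwap x≢y pipe-p pipe-q D-cross cross-unique D-bump bump-unique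
                       (passes-on pipe-p p-bump) (passes-on pipe-q q-bump)
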